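{- Let $\mathbb{C}_1,\dots,\mathbb{C}_n$ and $\mathbb{D}$ be comonads on categories $\mathcal{C}_1,\dots,\mathcal{C}_n$ and $\mathcal{D}$ respectively, and $H\colon\prod_i\mathcal{C}_i\to\mathcal{D}$ a functor. If there exists a Kleisli law of type $\mathbb{D}\circ H\Rightarrow H\circ\prod_i\mathbb{C}_i$, then for all objects $A_i,B_i\in\mathcal{C}_i$: if $A_i\cong_{\mathbb{C}_i}B_i$ for every $i=1,\dots,n$, then $H(A_1,\dots,A_n)\cong_{\mathbb{D}}H(B_1,\dots,B_n)$.
   Context: Comonads $(\mathbb{C},\varepsilon,\delta)$ have counit $\varepsilon$ and comultiplication $\delta$. The Kleisli category of $\mathbb{C}$ has the objects of $\mathcal{C}$, morphisms $A\to B$ are morphisms $\mathbb{C}(A)\to B$ of $\mathcal{C}$, identities are $\varepsilon_A$, and the composite of $f\colon\mathbb{C}(A)\to B$ and $g\colon\mathbb{C}(B)\to C$ is $g\circ f^*$ where $f^*=\mathbb{C}(f)\circ\delta_A$. Write $A\cong_{\mathbb{C}}B$ if $A$ and $B$ are isomorphic in the Kleisli category of $\mathbb{C}$. A Kleisli law of type $\mathbb{D}\circ H\Rightarrow H\circ\prod_i\mathbb{C}_i$ is a natural transformation $\kappa$ with components $\kappa_{\vec A}\colon\mathbb{D}H(A_1,\dots,A_n)\to H(\mathbb{C}_1A_1,\dots,\mathbb{C}_nA_n)$ such that $H(\varepsilon_{A_1},\dots,\varepsilon_{A_n})\circ\kappa_{\vec A}=\varepsilon_{H(\vec A)}$ and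 $\kappa_{\mathbb{C}_1A_1,\dots,\mathbb{C}_nA_n}\circ\mathbb{D}(\kappa_{\vec A})\circ\delta_{H(\vec A)}=H(\delta_{A_1},\dots,\delta_{A_n})\circ\kappa_{\vec A}$. -}

module Defs where

open import Level using (Level; _⊔_) renaming (suc to lsuc)
open import Data.Nat using (ℕ)
open import Data.Fin using (Fin)
open import Relation.Binary using (Rel; IsEquivalence)

record Category (o ℓ e : Level) : Set (lsuc (o ⊔ ℓ ⊔ e)) where
  infix  4 _≈_
  infixr 9 _∘_
  field
    Obj : Set o
    _⇒_ : Obj → Obj → Set ℓ
    _≈_ : ∀ {A B} → Rel (A ⇒ B) e
    id  : ∀ {A} → A ⇒ A
    _∘_ : ∀ {A B C} → B ⇒ C → A ⇒ B → A ⇒ C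
    assoc     : ∀ {A B C D} {f : A ⇒ B} {g : B ⇒ C} {h : C ⇒ D} →
                (h ∘ g) ∘ f ≈ h ∘ (g ∘ f)
    identityˡ : ∀ {A B} {f : A ⇒ B} → id ∘ f ≈ f
    identityʳ : ∀ {A B} {f : A ⇒ B} → f ∘ id ≈ f
    equiv     : ∀ {A B} → IsEquivalence (_≈_ {A} {B})
    ∘-resp-≈  : ∀ {A B C} {f h : B ⇒ C} {g i : A ⇒ B} →
                f ≈ h → g ≈ i → f ∘ g ≈ h ∘ i

record Functor {o ℓ e o′ ℓ′ e′ : Level}
               (C : Category o ℓ e) (D : Category o′ ℓ′ e′)
               : Set (o ⊔ ℓ ⊔ e ⊔ o′ ⊔ ℓ′ ⊔ e′) where
  private
    module C = Category C
    module D = Category D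
  field
    F₀ : C.Obj → D.Obj
    F₁ : ∀ {A B} → A C.⇒ B → F₀ A D.⇒ F₀ B
    identity     : ∀ {A} → F₁ (C.id {A}) D.≈ D.id
    homomorphism : ∀ {X Y Z} {f : X C.⇒ Y} {g : Y C.⇒ Z} →
                   F₁ (g C.∘ f) D.≈ F₁ g D.∘ F₁ f
    F-resp-≈     : ∀ {A B} {f g : A C.⇒ B} → f C.≈ g → F₁ f D.≈ F₁ g

idF : ∀ {o ℓ e} (C : Category o ℓ e) → Functor C C
idF C = record
  { F₀ = λ A → A ; F₁ = λ f → f
  ; identity = IsEquivalence.refl equiv
  ; homomorphism = IsEquivalence.refl equiv
  ; F-resp-≈ = λ p → p }
  where open Category C

_∘F_ : ∀ {o₁ ℓ₁ e₁ o₂ ℓ₂ e₂ o₃ ℓ₃ e₃}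
         {C : Category o₁ ℓ₁ e₁} {D : Category o₂ ℓ₂ e₂} {E : Category o₃ ℓ₃ e₃} →
       Functor D E → Functor C D → Functor C E
_∘F_ {E = E} G F = record
  { F₀ = λ A → G.F₀ (F.F₀ A)
  ; F₁ = λ f → G.F₁ (F.F₁ f)
  ; identity = IsEquivalence.trans E.equiv (G.F-resp-≈ F.identity) G.identity
  ; homomorphism = IsEquivalence.trans E.equiv (G.F-resp-≈ F.homomorphism) G.homomorphism
  ; F-resp-≈ = λ p → G.F-resp-≈ (F.F-resp-≈ p) }
  where
    module G = Functor G
    module F = Functor F
    module E = Category E

record NatTrans {o ℓ e o′ ℓ′ e′ : Level}
                {C : Category o ℓ e} {D : Category o′ ℓ′ e′}
                (F G : Functor C D) : Set (o ⊔ ℓ ⊔ e ⊔ o′ ⊔ ℓ′ ⊔ e′) where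
  private
    module C = Category C
    module D = Category D
    module F = Functor F
    module G = Functor G
  field
    η       : ∀ A → F.F₀ A D.⇒ G.F₀ A
    commute : ∀ {A B} (f : A C.⇒ B) → η B D.∘ F.F₁ f D.≈ G.F₁ f D.∘ η A

record Comonad {o ℓ e : Level} (C : Category o ℓ e) : Set (o ⊔ ℓ ⊔ e) where
  open Category C
  field
    F : Functor C C
    ε : NatTrans F (idF C)
    δ : NatTrans F (F ∘F F)
  open Functor F public
  ε[_] : ∀ A → F₀ A ⇒ A
  ε[ A ] = NatTrans.η ε A
  δ[_] : ∀ A → F₀ A ⇒ F₀ (F₀ A)
  δ[ A ] = NatTrans.η δ A
  field
    identityˡ′ : ∀ {A} → ε[ F₀ A ] ∘ δ[ A ] ≈ id
    identityʳ′ : ∀ {A} → F₁ ε[ A ] ∘ δ[ A ] ≈ id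
    assoc′     : ∀ {A} → δ[ F₀ A ] ∘ δ[ A ] ≈ F₁ δ[ A ] ∘ δ[ A ]

  _* : ∀ {A B} → F₀ A ⇒ B → F₀ A ⇒ F₀ B
  _* {A} f = F₁ f ∘ δ[ A ]

record KleisliIso {o ℓ e : Level} {C : Category o ℓ e} (𝕔 : Comonad C)
                  (A B : Category.Obj C) : Set (ℓ ⊔ e) where
  open Category C
  open Comonad 𝕔
  field
    to   : F₀ A ⇒ B
    from : F₀ B ⇒ A
    isoˡ : from ∘ (to *) ≈ ε[ A ]
    isoʳ : to ∘ (from *) ≈ ε[ B ]

Product : ∀ {o ℓ e} {n : ℕ} → (Fin n → Category o ℓ e) → Category o ℓ e
Product {n = n} 𝒞 = record
  { Obj = (i : Fin n) → Obj (𝒞 i)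
  ; _⇒_ = λ A B → (i : Fin n) → _⇒_ (𝒞 i) (A i) (B i)
  ; _≈_ = λ f g → (i : Fin n) → _≈_ (𝒞 i) (f i) (g i)
  ; id = λ i → id (𝒞 i)
  ; _∘_ = λ f g i → _∘_ (𝒞 i) (f i) (g i)
  ; assoc = λ i → assoc (𝒞 i)
  ; identityˡ = λ i → identityˡ (𝒞 i)
  ; identityʳ = λ i → identityʳ (𝒞 i)
  ; equiv = record
      { refl  = λ i → IsEquivalence.refl (equiv (𝒞 i))
      ; sym   = λ p i → IsEquivalence.sym (equiv (𝒞 i)) (p i)
      ; trans = λ p q i → IsEquivalence.trans (equiv (𝒞 i)) (p i) (q i) }
  ; ∘-resp-≈ = λ p q i → ∘-resp-≈ (𝒞 i) (p i) (q i)
  }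
  where open Category

ProductF : ∀ {o ℓ e} {n : ℕ} {𝒞 : Fin n → Category o ℓ e} →
           ((i : Fin n) → Functor (𝒞 i) (𝒞 i)) → Functor (Product 𝒞) (Product 𝒞)
ProductF Fs = record
  { F₀ = λ A i → Functor.F₀ (Fs i) (A i)
  ; F₁ = λ f i → Functor.F₁ (Fs i) (f i)
  ; identity = λ i → Functor.identity (Fs i)
  ; homomorphism = λ i → Functor.homomorphism (Fs i)
  ; F-resp-≈ = λ p i → Functor.F-resp-≈ (Fs i) (p i) }

record KleisliLaw {o ℓ e o′ ℓ′ e′ : Level} {n : ℕ}
                  {𝒞 : Fin n → Category o ℓ e} {𝒟 : Category o′ ℓ′ e′}
                  (ℂ : (i : Fin n) → Comonad (𝒞 i)) (𝔻 : Comonad 𝒟)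
                  (H : Functor (Product 𝒞) 𝒟) : Set (o ⊔ ℓ ⊔ e ⊔ o′ ⊔ ℓ′ ⊔ e′) where
  open Category 𝒟
  private
    module H = Functor H
    module 𝔻 = Comonad 𝔻
    Πℂ : Functor (Product 𝒞) (Product 𝒞)
    Πℂ = ProductF (λ i → Comonad.F (ℂ i))
    module Πℂ = Functor Πℂ
  field
    κ : NatTrans (𝔻.F ∘F H) (H ∘F Πℂ)
  κ[_] : ∀ A → 𝔻.F₀ (H.F₀ A) ⇒ H.F₀ (Πℂ.F₀ A)
  κ[ A ] = NatTrans.η κ A
  field
    counit : ∀ {A} → H.F₁ (λ i → Comonad.ε[_] (ℂ i) (A i)) ∘ κ[ A ] ≈ 𝔻.ε[ H.F₀ A ]
    comult : ∀ {A} → κ[ Πℂ.F₀ A ] ∘ 𝔻.F₁ κ[ A ] ∘ 𝔻.δ[ H.F₀ A ]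
                     ≈ H.F₁ (λ i → Comonad.δ[_] (ℂ i) (A i)) ∘ κ[ A ]

module Submission where

-- A Kleisli law κ lets us lift a Kleisli morphism f : ∏ᵢ ℂᵢAᵢ → B of the product comonad
-- to the 𝔻-Kleisli morphism H(f) ∘ κ_A : 𝔻H(A) → H(B). The counit law sends identities to
-- identities, and naturality together with the comultiplication law makes κ carry the
-- coextension of a lift to the lift of the coextension, so lifting is functorial on Kleisli
-- categories. A functor preserves isomorphisms, and a family of Kleisli isomorphisms
-- fᵢ : Aᵢ ≅ Bᵢ is precisely a Kleisli isomorphism of the product comonad.

open import Defs
open import Data.Nat using (ℕ)
open import Data.Fin using (Fin)
open import Relation.Binary using (Setoid; IsEquivalence)
import Relation.Binary.Reasoning.Setoid as SetoidReasoning

module KleisliLift {o ℓ e o′ ℓ′ e′} {n : ℕ}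
    {𝒞 : Fin n → Category o ℓ e} {ℂ : (i : Fin n) → Comonad (𝒞 i)}
    {𝒟 : Category o′ ℓ′ e′} {𝔻 : Comonad 𝒟}
    {H : Functor (Product 𝒞) 𝒟} (L : KleisliLaw ℂ 𝔻 H) where

  open Category 𝒟
  private
    module H = Functor H
    module 𝔻 = Comonad 𝔻
    module L = KleisliLaw L
    module P = Category (Product 𝒞)
    module Πℂ = Functor (ProductF (λ i → Comonad.F (ℂ i)))
    module ≈ {X Y} = IsEquivalence (equiv {X} {Y})

    hom : Obj → Obj → Setoid ℓ′ e′
    hom X Y = record { Carrier = X ⇒ Y ; _≈_ = _≈_ ; isEquivalence = equiv }

  εΠ[_] : ∀ A → Πℂ.F₀ A P.⇒ A
  εΠ[ A ] i = Comonad.ε[_] (ℂ i) (A i)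

  δΠ[_] : ∀ A → Πℂ.F₀ A P.⇒ Πℂ.F₀ (Πℂ.F₀ A)
  δΠ[ A ] i = Comonad.δ[_] (ℂ i) (A i)

  coextendΠ : ∀ {A B} → Πℂ.F₀ A P.⇒ B → Πℂ.F₀ A P.⇒ Πℂ.F₀ B
  coextendΠ {A} f = Πℂ.F₁ f P.∘ δΠ[ A ]

  lift : ∀ {A B} → Πℂ.F₀ A P.⇒ B → 𝔻.F₀ (H.F₀ A) ⇒ H.F₀ B
  lift {A} f = H.F₁ f ∘ L.κ[ A ]

  lift-resp-≈ : ∀ {A B} {f g : Πℂ.F₀ A P.⇒ B} → f P.≈ g → lift f ≈ lift g
  lift-resp-≈ f≈g = ∘-resp-≈ (H.F-resp-≈ f≈g) ≈.refl

  lift-identity : ∀ {A} → lift εΠ[ A ] ≈ 𝔻.ε[ H.F₀ A ]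
  lift-identity = L.counit

  κ-coextend : ∀ {A B} (f : Πℂ.F₀ A P.⇒ B) → L.κ[ B ] ∘ (lift f 𝔻.*) ≈ lift (coextendΠ f)
  κ-coextend {A} {B} f = begin
      L.κ[ B ] ∘ (𝔻.F₁ (H.F₁ f ∘ L.κ[ A ]) ∘ δ)
    ≈⟨ ∘-resp-≈ ≈.refl (∘-resp-≈ 𝔻.homomorphism ≈.refl) ⟩
      L.κ[ B ] ∘ ((𝔻.F₁ (H.F₁ f) ∘ 𝔻.F₁ L.κ[ A ]) ∘ δ)
    ≈⟨ ∘-resp-≈ ≈.refl assoc ⟩
      L.κ[ B ] ∘ (𝔻.F₁ (H.F₁ f) ∘ (𝔻.F₁ L.κ[ A ] ∘ δ))
    ≈⟨ ≈.sym assoc ⟩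
      (L.κ[ B ] ∘ 𝔻.F₁ (H.F₁ f)) ∘ (𝔻.F₁ L.κ[ A ] ∘ δ)
    ≈⟨ ∘-resp-≈ (NatTrans.commute L.κ f) ≈.refl ⟩
      (H.F₁ (Πℂ.F₁ f) ∘ L.κ[ Πℂ.F₀ A ]) ∘ (𝔻.F₁ L.κ[ A ] ∘ δ)
    ≈⟨ assoc ⟩
      H.F₁ (Πℂ.F₁ f) ∘ (L.κ[ Πℂ.F₀ A ] ∘ 𝔻.F₁ L.κ[ A ] ∘ δ)
    ≈⟨ ∘-resp-≈ ≈.refl L.comult ⟩
      H.F₁ (Πℂ.F₁ f) ∘ (H.F₁ δΠ[ A ] ∘ L.κ[ A ])
    ≈⟨ ≈.sym assoc ⟩
      (H.F₁ (Πℂ.F₁ f) ∘ H.F₁ δΠ[ A ]) ∘ L.κ[ A ]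
    ≈⟨ ∘-resp-≈ (≈.sym H.homomorphism) ≈.refl ⟩
      H.F₁ (coextendΠ f) ∘ L.κ[ A ]
    ∎
    where
      open SetoidReasoning (hom _ _)
      δ = 𝔻.δ[ H.F₀ A ]

  lift-homomorphism : ∀ {A B C} (f : Πℂ.F₀ A P.⇒ B) (g : Πℂ.F₀ B P.⇒ C) →
                      lift g ∘ (lift f 𝔻.*) ≈ lift (g P.∘ coextendΠ f)
  lift-homomorphism {A} {B} f g = begin
      (H.F₁ g ∘ L.κ[ B ]) ∘ (lift f 𝔻.*)  ≈⟨ assoc ⟩
      H.F₁ g ∘ (L.κ[ B ] ∘ (lift f 𝔻.*))  ≈⟨ ∘-resp-≈ ≈.refl (κ-coextend f) ⟩
      H.F₁ g ∘ (H.F₁ (coextendΠ f) ∘ L.κ[ A ])  ≈⟨ ≈.sym assoc ⟩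
      (H.F₁ g ∘ H.F₁ (coextendΠ f)) ∘ L.κ[ A ]  ≈⟨ ∘-resp-≈ (≈.sym H.homomorphism) ≈.refl ⟩
      lift (g P.∘ coextendΠ f)  ∎
    where open SetoidReasoning (hom _ _)

  lift-inverse : ∀ {A B} {f : Πℂ.F₀ A P.⇒ B} {g : Πℂ.F₀ B P.⇒ A} →
                 g P.∘ coextendΠ f P.≈ εΠ[ A ] → lift g ∘ (lift f 𝔻.*) ≈ 𝔻.ε[ H.F₀ A ]
  lift-inverse {f = f} {g} g∘f*≈ε =
    ≈.trans (lift-homomorphism f g) (≈.trans (lift-resp-≈ g∘f*≈ε) lift-identity)

theorem3 : ∀ {o ℓ e o′ ℓ′ e′} (n : ℕ)
             (𝒞 : Fin n → Category o ℓ e) (ℂ : (i : Fin n) → Comonad (𝒞 i))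
             (𝒟 : Category o′ ℓ′ e′) (𝔻 : Comonad 𝒟)
             (H : Functor (Product 𝒞) 𝒟) →
             KleisliLaw ℂ 𝔻 H →
             (A B : (i : Fin n) → Category.Obj (𝒞 i)) →
             ((i : Fin n) → KleisliIso (ℂ i) (A i) (B i)) →
             KleisliIso 𝔻 (Functor.F₀ H A) (Functor.F₀ H B)
theorem3 n 𝒞 ℂ 𝒟 𝔻 H L A B isos = record
  { to   = lift (λ i → KleisliIso.to (isos i))
  ; from = lift (λ i → KleisliIso.from (isos i))
  ; isoˡ = lift-inverse (λ i → KleisliIso.isoˡ (isos i))
  ; isoʳ = lift-inverse (λ i → KleisliIso.isoʳ (isos i))
  }
  where open KleisliLift L
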